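{- For every connected simple graph $G$, the vectors $z(e),z'(e)$ ($e\in E(G)$) are Farkas-related.
   Context: Let $V(G)=\{1,\dots,n\}$, $E(G)=\{e_1,\dots,e_m\}$, and $f_1,\dots,f_n,g_1,\dots,g_m$ the standard basis of $\mathbb{Z}^n\oplus\mathbb{Z}^m$. For each edge $e=e_k=ij$ with $i<j$, $z(e)=f_i-f_j+g_k$ and $z'(e)=-f_i+f_j+g_k$. Vectors $v_1,\dots,v_p\in\mathbb{Z}^N$ are Farkas-related if: for arbitrary integers $a_i\le b_i$, whenever $w\in\sum\mathbb{Z}v_i$ can be written as $w=\sum x_iv_i$ with rational $a_i\le x_i\le b_i$, it can also be written as $w=\sum y_iv_i$ with integers $a_i\le y_i\le b_i$. -}

module Defs where

open import Data.Nat as ℕ using (ℕ; zero; suc)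
open import Data.Integer as ℤ using (ℤ; +_; 0ℤ; 1ℤ)
open import Data.Rational as ℚ using (ℚ; 0ℚ)
open import Data.Fin using (Fin; zero; suc; splitAt; _<_)
open import Data.Fin.Properties using (_≟_)
open import Data.Product using (Σ; ∃; _×_; _,_; proj₁; proj₂)
open import Data.Sum using (_⊎_; inj₁; inj₂)
open import Function.Definitions using (Injective)
open import Relation.Binary.PropositionalEquality using (_≡_)
open import Relation.Binary.Construct.Closure.ReflexiveTransitive using (Star)
open import Relation.Nullary.Decidable using (does)
open import Data.Bool using (if_then_else_)

sumℤ : ∀ {p} → (Fin p → ℤ) → ℤ
sumℤ {zero}  f = 0ℤ
sumℤ {suc p} f = f zero ℤ.+ sumℤ (λ i → f (suc i))

sumℚ : ∀ {p} → (Fin p → ℚ) → ℚ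
sumℚ {zero}  f = 0ℚ
sumℚ {suc p} f = f zero ℚ.+ sumℚ (λ i → f (suc i))

toℚ : ℤ → ℚ
toℚ z = z ℚ./ 1

combℤ : ∀ {p N} → (Fin p → Fin N → ℤ) → (Fin p → ℤ) → Fin N → ℤ
combℤ v y k = sumℤ (λ i → y i ℤ.* v i k)

combℚ : ∀ {p N} → (Fin p → Fin N → ℤ) → (Fin p → ℚ) → Fin N → ℚ
combℚ v x k = sumℚ (λ i → x i ℚ.* toℚ (v i k))

InLattice : ∀ {p N} → (Fin p → Fin N → ℤ) → (Fin N → ℤ) → Set
InLattice v w = ∃ λ (c : _) → ∀ k → combℤ v c k ≡ w k

FarkasRelated : ∀ {p N} → (Fin p → Fin N → ℤ) → Set
FarkasRelated {p} {N} v =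
  (a b : Fin p → ℤ) → (∀ i → a i ℤ.≤ b i) →
  (w : Fin N → ℤ) → InLattice v w →
  (∃ λ (x : Fin p → ℚ) →
     (∀ i → (toℚ (a i) ℚ.≤ x i) × (x i ℚ.≤ toℚ (b i))) ×
     (∀ k → combℚ v x k ≡ toℚ (w k))) →
  ∃ λ (y : Fin p → ℤ) →
     (∀ i → (a i ℤ.≤ y i) × (y i ℤ.≤ b i)) ×
     (∀ k → combℤ v y k ≡ w k)

-- Edge e_k = ij is stored as the pair (i , j) with i < j; distinct indices
-- give distinct edges (no multi-edges), and i < j excludes loops.

record SimpleGraph (n m : ℕ) : Set where
  field
    edge    : Fin m → Fin n × Fin n
    ordered : ∀ k → proj₁ (edge k) < proj₂ (edge k)
    distinct : Injective _≡_ _≡_ edge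

open SimpleGraph public

Adjacent : ∀ {n m} → SimpleGraph n m → Fin n → Fin n → Set
Adjacent G u v = ∃ λ k → (edge G k ≡ (u , v)) ⊎ (edge G k ≡ (v , u))

Connected : ∀ {n m} → SimpleGraph n m → Set
Connected G = ∀ u v → Star (Adjacent G) u v

-- The vectors z(e), z'(e) in ℤ^n ⊕ ℤ^m = ℤ^(n+m)
-- (coordinate t : Fin (n + m); first n coordinates are f_1..f_n,
-- last m coordinates are g_1..g_m)

δ : ∀ {q} → Fin q → Fin q → ℤ
δ s t = if does (s ≟ t) then 1ℤ else 0ℤ

z : ∀ {n m} → SimpleGraph n m → Fin m → Fin (n ℕ.+ m) → ℤ
z {n} G k t with splitAt n t
... | inj₁ s = δ (proj₁ (edge G k)) s ℤ.- δ (proj₂ (edge G k)) s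
... | inj₂ l = δ k l

z′ : ∀ {n m} → SimpleGraph n m → Fin m → Fin (n ℕ.+ m) → ℤ
z′ {n} G k t with splitAt n t
... | inj₁ s = δ (proj₂ (edge G k)) s ℤ.- δ (proj₁ (edge G k)) s
... | inj₂ l = δ k l

zFamily : ∀ {n m} → SimpleGraph n m → Fin (m ℕ.+ m) → Fin (n ℕ.+ m) → ℤ
zFamily {n} {m} G r with splitAt m r
... | inj₁ k = z G k
... | inj₂ k = z′ G k

module Submission where

-- Orient each edge from its smaller to its larger
-- endpoint.  A coefficient vector on the family is a pair (u, u′) of edge vectors; its
-- combination has edge coordinates u + u′ and vertex coordinates div u - div u′, where
-- div is the net outflow at a vertex.  So the integer kernel consists of the pairs
-- (τ, -τ) with τ an integer circulation.  Given an integer representation c of w and a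
-- rational one x in the box [a, b], clear denominators (D x integral): the z-half T of
-- D x - D c is a circulation with D α ≤ T ≤ D β for integer bounds α, β read off from the
-- box.  Hoffman's integrality theorem gives an integer circulation α ≤ τ ≤ β, and then
-- c + (τ, -τ) is an integer representation of w in the box.

open import Defs
open import Data.Nat as ℕ using (ℕ; zero; suc)
import Data.Nat.Properties as ℕP
open import Data.Integer using (ℤ; +_; -[1+_]; 0ℤ; 1ℤ; -1ℤ; _+_; _*_; _-_; -_; _≤_; _<_; +≤+; _⊔_; _⊓_)
import Data.Integer.Properties as ℤP
open import Data.Integer.Divisibility.Signed as ℤ∣ using (_∣_; divides; _∣?_)
open import Data.Integer.Solver using (module +-*-Solver)
open import Data.Rational as ℚ using (ℚ; ↥_; ↧_)
import Data.Rational.Properties as ℚP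
open import Data.Rational.Unnormalised as ℚᵘ using (ℚᵘ; mkℚᵘ; *≡*; *≤*)
import Data.Rational.Unnormalised.Properties as ℚᵘP
open import Data.Fin using (Fin; zero; suc; _↑ˡ_; _↑ʳ_; splitAt)
open import Data.Fin.Properties as FinP using (_≟_; any?; splitAt-↑ˡ; splitAt-↑ʳ; splitAt⁻¹-↑ˡ; splitAt⁻¹-↑ʳ)
open import Data.Bool using (Bool; true; false; not; if_then_else_)
import Data.Bool.Properties as BoolP
open import Data.Product using (Σ; ∃; _×_; _,_; proj₁; proj₂)
open import Data.Sum using (_⊎_; inj₁; inj₂; [_,_]′)
open import Data.Empty using (⊥-elim)
open import Relation.Binary.PropositionalEquality
open import Relation.Binary.Construct.Closure.ReflexiveTransitive using (Star; ε; _◅_; _◅◅_)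
open import Relation.Nullary using (Dec; yes; no; ¬_; does)
open import Relation.Nullary.Decidable using (_×-dec_; _⊎-dec_; ¬?; dec-false)
open import Algebra.Bundles using (AbelianGroup)
open import Algebra.Properties.Group (AbelianGroup.group ℤP.+-0-abelianGroup) using (inverseʳ-unique)

open +-*-Solver

sum-cong : ∀ {p} {f g : Fin p → ℤ} → (∀ i → f i ≡ g i) → sumℤ f ≡ sumℤ g
sum-cong {zero}  eq = refl
sum-cong {suc p} eq = cong₂ _+_ (eq zero) (sum-cong (λ i → eq (suc i)))

sum-zero : ∀ p → sumℤ {p} (λ _ → 0ℤ) ≡ 0ℤ
sum-zero zero    = refl
sum-zero (suc p) = trans (ℤP.+-identityˡ _) (sum-zero p)

sum-+ : ∀ {p} (f g : Fin p → ℤ) → sumℤ (λ i → f i + g i) ≡ sumℤ f + sumℤ g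
sum-+ {zero}  f g = refl
sum-+ {suc p} f g = begin
  (f zero + g zero) + sumℤ (λ i → f (suc i) + g (suc i))
    ≡⟨ cong (_+_ (f zero + g zero)) (sum-+ (λ i → f (suc i)) (λ i → g (suc i))) ⟩
  (f zero + g zero) + (sumℤ (λ i → f (suc i)) + sumℤ (λ i → g (suc i)))
    ≡⟨ solve 4 (λ a b c d → (a :+ b) :+ (c :+ d) := (a :+ c) :+ (b :+ d)) refl
         (f zero) (g zero) (sumℤ (λ i → f (suc i))) (sumℤ (λ i → g (suc i))) ⟩
  sumℤ f + sumℤ g ∎
  where open ≡-Reasoning

sum-scale : ∀ {p} c (f : Fin p → ℤ) → sumℤ (λ i → c * f i) ≡ c * sumℤ f
sum-scale {zero}  c f = sym (ℤP.*-zeroʳ c)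
sum-scale {suc p} c f =
  trans (cong (_+_ (c * f zero)) (sum-scale c (λ i → f (suc i))))
        (sym (ℤP.*-distribˡ-+ c (f zero) _))

sum-neg : ∀ {p} (f : Fin p → ℤ) → sumℤ (λ i → - f i) ≡ - sumℤ f
sum-neg f = trans (sum-cong (λ i → sym (ℤP.-1*i≡-i (f i))))
                  (trans (sum-scale -1ℤ f) (ℤP.-1*i≡-i (sumℤ f)))

sum-swap : ∀ {p q} (f : Fin p → Fin q → ℤ) →
  sumℤ (λ i → sumℤ (λ j → f i j)) ≡ sumℤ (λ j → sumℤ (λ i → f i j))
sum-swap {zero}  {q} f = sym (sum-zero q)
sum-swap {suc p} {q} f =
  trans (cong (_+_ (sumℤ (f zero))) (sum-swap (λ i → f (suc i))))
        (sym (sum-+ (f zero) (λ j → sumℤ (λ i → f (suc i) j))))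

sum-split : ∀ {p q} (f : Fin (p ℕ.+ q) → ℤ) →
  sumℤ f ≡ sumℤ (λ i → f (i ↑ˡ q)) + sumℤ (λ j → f (p ↑ʳ j))
sum-split {zero}  f = sym (ℤP.+-identityˡ _)
sum-split {suc p} {q} f =
  trans (cong (_+_ (f zero)) (sum-split {p} {q} (λ i → f (suc i))))
        (sym (ℤP.+-assoc (f zero) (sumℤ (λ i → f (suc i ↑ˡ q))) (sumℤ (λ j → f (suc p ↑ʳ j)))))

∣-sum : ∀ {p} (D : ℤ) (f : Fin p → ℤ) → (∀ i → D ∣ f i) → D ∣ sumℤ f
∣-sum {zero}  D f h = divides 0ℤ refl
∣-sum {suc p} D f h = ℤ∣.∣m∣n⇒∣m+n (h zero) (∣-sum D (λ i → f (suc i)) (λ i → h (suc i)))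

∣-sum-term : ∀ {p} (D : ℤ) (f : Fin p → ℤ) (e : Fin p) →
  (∀ i → i ≢ e → D ∣ f i) → D ∣ sumℤ f → D ∣ f e
∣-sum-term {suc p} D f zero    h hs =
  ℤ∣.∣m+n∣n⇒∣m hs (∣-sum D (λ i → f (suc i)) (λ i → h (suc i) (λ ())))
∣-sum-term {suc p} D f (suc e) h hs =
  ∣-sum-term D (λ i → f (suc i)) e (λ i i≢e → h (suc i) (λ eq → i≢e (FinP.suc-injective eq)))
    (ℤ∣.∣m+n∣m⇒∣n hs (h zero (λ ())))

δ-self : ∀ {q} (l : Fin q) → δ l l ≡ 1ℤ
δ-self zero    = refl
δ-self (suc l) = δ-self l

δ-sym : ∀ {q} (k l : Fin q) → δ k l ≡ δ l k
δ-sym zero    zero    = refl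
δ-sym zero    (suc l) = refl
δ-sym (suc k) zero    = refl
δ-sym (suc k) (suc l) = δ-sym k l

δ-off : ∀ {q} (k l : Fin q) → k ≢ l → δ k l ≡ 0ℤ
δ-off k l k≢l with k ≟ l
... | yes k≡l = ⊥-elim (k≢l k≡l)
... | no  _   = refl

sum-δʳ : ∀ {q} (f : Fin q → ℤ) (l : Fin q) → sumℤ (λ i → f i * δ i l) ≡ f l
sum-δʳ {suc q} f zero = begin
  f zero * 1ℤ + sumℤ (λ i → f (suc i) * 0ℤ)
    ≡⟨ cong₂ _+_ (ℤP.*-identityʳ (f zero))
                   (trans (sum-cong (λ i → ℤP.*-zeroʳ (f (suc i)))) (sum-zero q)) ⟩
  f zero + 0ℤ ≡⟨ ℤP.+-identityʳ (f zero) ⟩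
  f zero ∎
  where open ≡-Reasoning
sum-δʳ {suc q} f (suc l) = begin
  f zero * 0ℤ + sumℤ (λ i → f (suc i) * δ i l)
    ≡⟨ cong₂ _+_ (ℤP.*-zeroʳ (f zero)) (sum-δʳ (λ i → f (suc i)) l) ⟩
  0ℤ + f (suc l) ≡⟨ ℤP.+-identityˡ _ ⟩
  f (suc l) ∎
  where open ≡-Reasoning

sum-δˡ : ∀ {q} (f : Fin q → ℤ) (l : Fin q) → sumℤ (λ i → δ l i * f i) ≡ f l
sum-δˡ f l = trans (sum-cong (λ i → trans (ℤP.*-comm (δ l i) (f i)) (cong (f i *_) (δ-sym l i))))
                   (sum-δʳ f l)

-- The number of elements of Fin n satisfying a Boolean predicate; it is the
-- termination measure of both the reachability search and the main algorithm.

count : ∀ {n} → (Fin n → Bool) → ℕ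
count {zero}  P = 0
count {suc n} P = (if P zero then 1 else 0) ℕ.+ count (λ i → P (suc i))

count≤ : ∀ {n} (P : Fin n → Bool) → count P ℕ.≤ n
count≤ {zero}  P = ℕ.z≤n
count≤ {suc n} P with P zero
... | true  = ℕ.s≤s (count≤ (λ i → P (suc i)))
... | false = ℕP.m≤n⇒m≤1+n (count≤ (λ i → P (suc i)))

Implies : ∀ {n} → (Fin n → Bool) → (Fin n → Bool) → Set
Implies P Q = ∀ k → P k ≡ true → Q k ≡ true

count-mono : ∀ {n} (P Q : Fin n → Bool) → Implies P Q → count P ℕ.≤ count Q
count-mono {zero}  P Q P⇒Q = ℕ.z≤n
count-mono {suc n} P Q P⇒Q with P zero in P0
... | true rewrite P⇒Q zero P0 = ℕ.s≤s (count-mono _ _ (λ k → P⇒Q (suc k)))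
... | false = ℕP.≤-trans (count-mono _ _ (λ k → P⇒Q (suc k)))
                         (ℕP.m≤n+m _ (if Q zero then 1 else 0))

count-strict : ∀ {n} (P Q : Fin n → Bool) → Implies P Q →
  (e : Fin n) → P e ≡ false → Q e ≡ true → count P ℕ.< count Q
count-strict {suc n} P Q P⇒Q zero Pe Qe rewrite Pe | Qe =
  ℕ.s≤s (count-mono _ _ (λ k → P⇒Q (suc k)))
count-strict {suc n} P Q P⇒Q (suc e) Pe Qe with P zero in P0
... | true rewrite P⇒Q zero P0 = ℕ.s≤s (count-strict _ _ (λ k → P⇒Q (suc k)) e Pe Qe)
... | false = ℕP.<-≤-trans (count-strict _ _ (λ k → P⇒Q (suc k)) e Pe Qe)
                           (ℕP.m≤n+m _ (if Q zero then 1 else 0))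

count-pos : ∀ {n} (P : Fin n → Bool) (e : Fin n) → P e ≡ true → 0 ℕ.< count P
count-pos P e Pe = ℕP.≤-trans (ℕ.s≤s ℕ.z≤n) (count-strict (λ _ → false) P (λ k ()) e refl Pe)

-- The search grows the
-- set of vertices known to be reachable from a, one vertex at a time.

module Reachability {n : ℕ} (R : Fin n → Fin n → Set) (R? : ∀ x y → Dec (R x y)) where

  Closed : (Fin n → Bool) → Set
  Closed S = ∀ x y → R x y → S x ≡ true → S y ≡ true

  ReachOrCut : Fin n → Fin n → Set
  ReachOrCut a b = Star R a b ⊎ Σ (Fin n → Bool) (λ S → S a ≡ true × S b ≡ false × Closed S)

  insert : (Fin n → Bool) → Fin n → Fin n → Bool
  insert S y z = if does (y ≟ z) then true else S z

  insert-⊇ : ∀ S y z → S z ≡ true → insert S y z ≡ true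
  insert-⊇ S y z Sz with does (y ≟ z)
  ... | true  = refl
  ... | false = Sz

  insert-∋ : ∀ S y → insert S y y ≡ true
  insert-∋ S y with y ≟ y
  ... | yes _   = refl
  ... | no  y≢y = ⊥-elim (y≢y refl)

  insert-cases : ∀ S y z → insert S y z ≡ true → S z ≡ true ⊎ y ≡ z
  insert-cases S y z h with y ≟ z
  ... | yes y≡z = inj₂ y≡z
  ... | no  _   = inj₁ h

  exit? : (S : Fin n → Bool) → Dec (∃ λ x → ∃ λ y → (S x ≡ true × S y ≡ false) × R x y)
  exit? S = any? (λ x → any? (λ y → ((S x BoolP.≟ true) ×-dec (S y BoolP.≟ false)) ×-dec R? x y))

  -- invariant: every member of S is reachable from a; the fuel bounds the
  -- number of non-members, which decreases in every round
  grow : (a b : Fin n) (fuel : ℕ) (S : Fin n → Bool) → count (λ z → not (S z)) ℕ.≤ fuel →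
         S a ≡ true → (∀ x → S x ≡ true → Star R a x) → ReachOrCut a b
  grow a b fuel S bound Sa reach with exit? S
  grow a b fuel S bound Sa reach | no noExit with S b in Sb
  ... | true  = inj₁ (reach b Sb)
  ... | false = inj₂ (S , Sa , Sb , closed)
    where
    closed : Closed S
    closed x y r Sx with S y in Sy
    ... | true  = refl
    ... | false = ⊥-elim (noExit (x , y , (Sx , Sy) , r))
  grow a b zero S bound Sa reach | yes (x , y , (Sx , Sy) , r) =
    ⊥-elim (ℕP.<⇒≱ (count-pos (λ z → not (S z)) y (cong not Sy)) bound)
  grow a b (suc fuel) S bound Sa reach | yes (x , y , (Sx , Sy) , r) =
    grow a b fuel (insert S y) bound′ (insert-⊇ S y a Sa) reach′
    where
    fewer : count (λ z → not (insert S y z)) ℕ.< count (λ z → not (S z))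
    fewer = count-strict _ _ outside y (cong not (insert-∋ S y)) (cong not Sy)
      where
      outside : Implies (λ z → not (insert S y z)) (λ z → not (S z))
      outside z h with S z | does (y ≟ z)
      ... | false | _     = refl
      ... | true  | true  = h
      ... | true  | false = h
    bound′ : count (λ z → not (insert S y z)) ℕ.≤ fuel
    bound′ = ℕP.≤-pred (ℕP.<-≤-trans fewer bound)
    reach′ : ∀ z → insert S y z ≡ true → Star R a z
    reach′ z h with insert-cases S y z h
    ... | inj₁ Sz   = reach z Sz
    ... | inj₂ refl = reach x Sx ◅◅ (r ◅ ε)

  reachOrCut : (a b : Fin n) → ReachOrCut a b
  reachOrCut a b = grow a b n (insert (λ _ → false) a) (count≤ _) (insert-∋ _ a) start
    where
    start : ∀ x → insert (λ _ → false) a x ≡ true → Star R a x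
    start x h with insert-cases (λ _ → false) a x h
    ... | inj₁ ()
    ... | inj₂ refl = ε

module Flows {n m : ℕ} (src tgt : Fin m → Fin n) where

  inc : Fin m → Fin n → ℤ
  inc k s = δ (src k) s - δ (tgt k) s

  div : (Fin m → ℤ) → Fin n → ℤ
  div T s = sumℤ (λ k → T k * inc k s)

  Circulation : (Fin m → ℤ) → Set
  Circulation T = ∀ s → div T s ≡ 0ℤ

  div-lin : ∀ a b T U s → div (λ k → a * T k + b * U k) s ≡ a * div T s + b * div U s
  div-lin a b T U s = begin
    sumℤ (λ k → (a * T k + b * U k) * inc k s)
      ≡⟨ sum-cong (λ k → distrib a b (T k) (U k) (inc k s)) ⟩
    sumℤ (λ k → a * (T k * inc k s) + b * (U k * inc k s))
      ≡⟨ sum-+ (λ k → a * (T k * inc k s)) (λ k → b * (U k * inc k s)) ⟩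
    sumℤ (λ k → a * (T k * inc k s)) + sumℤ (λ k → b * (U k * inc k s))
      ≡⟨ cong₂ _+_ (sum-scale a (λ k → T k * inc k s)) (sum-scale b (λ k → U k * inc k s)) ⟩
    a * div T s + b * div U s ∎
    where
    open ≡-Reasoning
    distrib : ∀ a b t u x → (a * t + b * u) * x ≡ a * (t * x) + b * (u * x)
    distrib = solve 5 (λ a b t u x → (a :* t :+ b :* u) :* x := a :* (t :* x) :+ b :* (u :* x)) refl

  circulation-lin : ∀ a b {T U} → Circulation T → Circulation U →
    Circulation (λ k → a * T k + b * U k)
  circulation-lin a b {T} {U} cT cU s = begin
    div (λ k → a * T k + b * U k) s ≡⟨ div-lin a b T U s ⟩
    a * div T s + b * div U s ≡⟨ cong₂ (λ u v → a * u + b * v) (cT s) (cU s) ⟩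
    a * 0ℤ + b * 0ℤ ≡⟨ cong₂ _+_ (ℤP.*-zeroʳ a) (ℤP.*-zeroʳ b) ⟩
    0ℤ ∎
    where open ≡-Reasoning

  div-cong : ∀ {T U} → (∀ k → T k ≡ U k) → ∀ s → div T s ≡ div U s
  div-cong T≡U s = sum-cong (λ k → cong (_* inc k s) (T≡U k))

  div-neg : ∀ T s → div (λ k → - T k) s ≡ - div T s
  div-neg T s = trans (sum-cong (λ k → sym (ℤP.neg-distribˡ-* (T k) (inc k s)))) (sum-neg (λ k → T k * inc k s))

  div-δ : ∀ k s → div (δ k) s ≡ inc k s
  div-δ k s = sum-δˡ (λ k′ → inc k′ s) k

  Joins : Fin m → Fin n → Fin n → Set
  Joins k x y = (src k ≡ x × tgt k ≡ y) ⊎ (src k ≡ y × tgt k ≡ x)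

  Adj : (Fin m → Set) → Fin n → Fin n → Set
  Adj U x y = ∃ λ k → U k × Joins k x y

  Adj? : ∀ {U} → (∀ k → Dec (U k)) → ∀ x y → Dec (Adj U x y)
  Adj? U? x y = any? (λ k → U? k ×-dec
    (((src k ≟ x) ×-dec (tgt k ≟ y)) ⊎-dec ((src k ≟ y) ×-dec (tgt k ≟ x))))

  direction : ∀ {k x y} → Joins k x y → ℤ
  direction (inj₁ _) = 1ℤ
  direction (inj₂ _) = -1ℤ

  direction-inc : ∀ {k x y} (j : Joins k x y) s → direction j * inc k s ≡ δ x s - δ y s
  direction-inc (inj₁ (refl , refl)) s = ℤP.*-identityˡ _
  direction-inc {k} (inj₂ (refl , refl)) s =
    solve 2 (λ u v → con -1ℤ :* (u :- v) := v :- u) refl (δ (src k) s) (δ (tgt k) s)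

  walkFlow : ∀ {U a b} → Star (Adj U) a b →
    Σ (Fin m → ℤ) λ p → (∀ s → div p s ≡ δ a s - δ b s) × (∀ k → ¬ U k → p k ≡ 0ℤ)
  walkFlow {a = a} ε = (λ _ → 0ℤ) , (λ s → trans (sum-zero m) (sym (ℤP.+-inverseʳ (δ a s)))) , (λ _ _ → refl)
  walkFlow {U} {a} {b} (_◅_ {j = y} (k , Uk , j) rest) with walkFlow rest
  ... | p , div-p , supp-p = q , div-q , supp-q
    where
    q : Fin m → ℤ
    q k′ = direction j * δ k k′ + 1ℤ * p k′
    div-q : ∀ s → div q s ≡ δ a s - δ b s
    div-q s = begin
      div q s                                           ≡⟨ div-lin (direction j) 1ℤ (δ k) p s ⟩
      direction j * div (δ k) s + 1ℤ * div p s          ≡⟨ cong₂ (λ u v → direction j * u + 1ℤ * v) (div-δ k s) (div-p s) ⟩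
      direction j * inc k s + 1ℤ * (δ y s - δ b s)      ≡⟨ cong (_+ 1ℤ * (δ y s - δ b s)) (direction-inc j s) ⟩
      (δ a s - δ y s) + 1ℤ * (δ y s - δ b s)            ≡⟨ telescope (δ a s) (δ y s) (δ b s) ⟩
      δ a s - δ b s ∎
      where
      open ≡-Reasoning
      telescope : ∀ u v w → (u - v) + 1ℤ * (v - w) ≡ u - w
      telescope = solve 3 (λ u v w → (u :- v) :+ con 1ℤ :* (v :- w) := u :- w) refl
    supp-q : ∀ k′ → ¬ U k′ → q k′ ≡ 0ℤ
    supp-q k′ ¬Uk′ rewrite supp-p k′ ¬Uk′ | δ-off k k′ (λ { refl → ¬Uk′ Uk }) =
      cong (_+ 1ℤ * 0ℤ) (ℤP.*-zeroʳ (direction j))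

  module Cut (S : Fin n → Bool) where

    indicator : Fin n → ℤ
    indicator s = if S s then 1ℤ else 0ℤ

    crossing : Fin m → ℤ
    crossing k = indicator (src k) - indicator (tgt k)

    crossing-sum : ∀ k → sumℤ (λ s → indicator s * inc k s) ≡ crossing k
    crossing-sum k = begin
      sumℤ (λ s → indicator s * inc k s)
        ≡⟨ sum-cong (λ s → split (indicator s) (δ (src k) s) (δ (tgt k) s)) ⟩
      sumℤ (λ s → δ (src k) s * indicator s + - (δ (tgt k) s * indicator s))
        ≡⟨ sum-+ (λ s → δ (src k) s * indicator s) (λ s → - (δ (tgt k) s * indicator s)) ⟩
      sumℤ (λ s → δ (src k) s * indicator s) + sumℤ (λ s → - (δ (tgt k) s * indicator s))
        ≡⟨ cong₂ _+_ (sum-δˡ indicator (src k))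
                     (trans (sum-neg (λ s → δ (tgt k) s * indicator s)) (cong -_ (sum-δˡ indicator (tgt k)))) ⟩
      crossing k ∎
      where
      open ≡-Reasoning
      split : ∀ x u v → x * (u - v) ≡ u * x + - (v * x)
      split = solve 3 (λ x u v → x :* (u :- v) := u :* x :+ :- (v :* x)) refl

    cut-balance : ∀ T → Circulation T → sumℤ (λ k → T k * crossing k) ≡ 0ℤ
    cut-balance T circ = begin
      sumℤ (λ k → T k * crossing k)
        ≡⟨ sum-cong (λ k → cong (T k *_) (sym (crossing-sum k))) ⟩
      sumℤ (λ k → T k * sumℤ (λ s → indicator s * inc k s))
        ≡⟨ sum-cong (λ k → sym (sum-scale (T k) (λ s → indicator s * inc k s))) ⟩
      sumℤ (λ k → sumℤ (λ s → T k * (indicator s * inc k s)))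
        ≡⟨ sum-swap (λ k s → T k * (indicator s * inc k s)) ⟩
      sumℤ (λ s → sumℤ (λ k → T k * (indicator s * inc k s)))
        ≡⟨ sum-cong (λ s → trans (sum-cong (λ k → exchange (T k) (indicator s) (inc k s)))
                                 (sum-scale (indicator s) (λ k → T k * inc k s))) ⟩
      sumℤ (λ s → indicator s * div T s)
        ≡⟨ sum-cong (λ s → trans (cong (indicator s *_) (circ s)) (ℤP.*-zeroʳ (indicator s))) ⟩
      sumℤ {n} (λ _ → 0ℤ) ≡⟨ sum-zero n ⟩
      0ℤ ∎
      where
      open ≡-Reasoning
      exchange : ∀ t x y → t * (x * y) ≡ x * (t * y)
      exchange = solve 3 (λ t x y → t :* (x :* y) := x :* (t :* y)) refl

  cut-divides : ∀ {U} (D : ℤ) (T : Fin m → ℤ) (S : Fin n → Bool) (e : Fin m) →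
    Circulation T → (∀ x y → Adj U x y → S x ≡ true → S y ≡ true) →
    S (tgt e) ≡ true → S (src e) ≡ false →
    (∀ k → k ≢ e → ¬ U k → D ∣ T k) → D ∣ T e
  cut-divides {U} D T S e circ closed S-tgt S-src off-U =
    subst (D ∣_) (ℤP.neg-involutive (T e)) (ℤ∣.∣m⇒∣-m D∣-Te)
    where
    open Cut S
    U-uncut : ∀ k → U k → crossing k ≡ 0ℤ
    U-uncut k Uk with S (src k) in Ss | S (tgt k) in St
    ... | true  | true  = refl
    ... | false | false = refl
    ... | true  | false with trans (sym (closed _ _ (k , Uk , inj₁ (refl , refl)) Ss)) St
    ... | ()
    U-uncut k Uk | false | true with trans (sym (closed _ _ (k , Uk , inj₂ (refl , refl)) St)) Ss
    ... | ()
    e-term : T e * crossing e ≡ - T e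
    e-term rewrite S-tgt | S-src = trans (ℤP.*-comm (T e) -1ℤ) (ℤP.-1*i≡-i (T e))
    -- an edge of U does not cross the cut, and every other edge ≠ e has a value divisible by D
    other-terms : ∀ k → k ≢ e → D ∣ T k * crossing k
    other-terms k k≢e with crossing k ℤP.≟ 0ℤ
    ... | yes c≡0 rewrite c≡0 | ℤP.*-zeroʳ (T k) = divides 0ℤ refl
    ... | no  c≢0 = ℤ∣.∣m⇒∣m*n (crossing k) (off-U k k≢e (λ Uk → c≢0 (U-uncut k Uk)))
    D∣-Te : D ∣ - T e
    D∣-Te = subst (D ∣_) e-term (∣-sum-term D (λ k → T k * crossing k) e other-terms
              (subst (D ∣_) (sym (cut-balance T circ)) (divides 0ℤ refl)))

  -- Then F carries an integer
  -- circulation g with g e = 1: a path from tgt e back to src e inside F - {e}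
  -- exists, since otherwise the cut of vertices reachable from tgt e would
  -- force D ∣ T e.
  cycle-through : (D : ℤ) (T : Fin m → ℤ) (F : Fin m → Bool) (e : Fin m) →
    Circulation T → (∀ k → F k ≡ false → D ∣ T k) → F e ≡ true → ¬ (D ∣ T e) →
    Σ (Fin m → ℤ) λ g → Circulation g × g e ≡ 1ℤ × (∀ k → F k ≡ false → g k ≡ 0ℤ)
  cycle-through D T F e circ off-F Fe D∤Te
    with Reachability.reachOrCut (Adj Usable) (Adj? usable?) (tgt e) (src e)
    where
    Usable : Fin m → Set
    Usable k = F k ≡ true × k ≢ e
    usable? : ∀ k → Dec (Usable k)
    usable? k = (F k BoolP.≟ true) ×-dec ¬? (k ≟ e)
  ... | inj₂ (S , S-tgt , S-src , closed) =
    ⊥-elim (D∤Te (cut-divides D T S e circ closed S-tgt S-src off-usable))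
    where
    off-usable : ∀ k → k ≢ e → ¬ (F k ≡ true × k ≢ e) → D ∣ T k
    off-usable k k≢e ¬usable with F k in Fk
    ... | true  = ⊥-elim (¬usable (refl , k≢e))
    ... | false = off-F k Fk
  ... | inj₁ path with walkFlow path
  ...   | p , div-p , supp-p = g , circ-g , g-e , supp-g
    where
    g : Fin m → ℤ
    g k = 1ℤ * δ e k + 1ℤ * p k
    circ-g : Circulation g
    circ-g s = begin
      div g s                                                  ≡⟨ div-lin 1ℤ 1ℤ (δ e) p s ⟩
      1ℤ * div (δ e) s + 1ℤ * div p s                          ≡⟨ cong₂ (λ u v → 1ℤ * u + 1ℤ * v) (div-δ e s) (div-p s) ⟩
      1ℤ * inc e s + 1ℤ * (δ (tgt e) s - δ (src e) s)          ≡⟨ cancel (δ (src e) s) (δ (tgt e) s) ⟩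
      0ℤ ∎
      where
      open ≡-Reasoning
      cancel : ∀ u v → 1ℤ * (u - v) + 1ℤ * (v - u) ≡ 0ℤ
      cancel = solve 2 (λ u v → con 1ℤ :* (u :- v) :+ con 1ℤ :* (v :- u) := con 0ℤ) refl
    g-e : g e ≡ 1ℤ
    g-e rewrite δ-self e | supp-p e (λ (_ , e≢e) → e≢e refl) = refl
    supp-g : ∀ k → F k ≡ false → g k ≡ 0ℤ
    supp-g k Fk rewrite supp-p k (λ (Fk′ , _) → BoolP.not-¬ Fk Fk′)
                      | δ-off e k (λ { refl → BoolP.not-¬ Fk Fe }) = refl

does-true : ∀ {P : Set} (P? : Dec P) → does P? ≡ true → P
does-true (yes p) _ = p

does-false : ∀ {P : Set} (P? : Dec P) → does P? ≡ false → ¬ P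
does-false (no ¬p) _ = ¬p

-- ∣ g ∣ - 1 for g ≠ 0, so that mkℚᵘ r (pred∣ g ∣) is the ratio r / ∣ g ∣
pred∣_∣ : ℤ → ℕ
pred∣ + zero ∣   = 0
pred∣ + suc n ∣  = n
pred∣ -[1+ n ] ∣ = n

-- the room a value t ∈ [lo, hi] has for moving in the direction of the sign of g
room : ℤ → ℤ → ℤ → ℤ → ℤ
room -[1+ _ ] lo hi t = t - lo
room (+ _)    lo hi t = hi - t

room-nonneg : ∀ g lo hi t → lo ≤ t → t ≤ hi → 0ℤ ≤ room g lo hi t
room-nonneg -[1+ _ ] lo hi t lo≤t t≤hi = ℤP.i≤j⇒0≤j-i lo≤t
room-nonneg (+ _)    lo hi t lo≤t t≤hi = ℤP.i≤j⇒0≤j-i t≤hi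

nonneg-* : ∀ a b → 0ℤ ≤ a → 0ℤ ≤ b → 0ℤ ≤ a * b
nonneg-* (+ x) (+ y) _ _ = subst (0ℤ ≤_) (ℤP.pos-* x y) (+≤+ ℕ.z≤n)

-- The arithmetic of one push, with scaling factor M = M′ + 1: the value t
-- becomes M t + r g.
module PushArithmetic (M′ : ℕ) where

  M : ℤ
  M = + suc M′

  stays-within : ∀ g t lo hi r → lo ≤ t → t ≤ hi → 0ℤ ≤ r →
    (g ≢ 0ℤ → r * + suc pred∣ g ∣ ≤ room g lo hi t * M) →
    (M * lo ≤ M * t + r * g) × (M * t + r * g ≤ M * hi)
  stays-within (+ zero) t lo hi r lo≤t t≤hi 0≤r step =
    subst (M * lo ≤_) (sym no-move) (ℤP.*-monoˡ-≤-nonNeg M lo≤t) ,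
    subst (_≤ M * hi) (sym no-move) (ℤP.*-monoˡ-≤-nonNeg M t≤hi)
    where
    no-move : M * t + r * + 0 ≡ M * t
    no-move = solve 3 (λ M t r → M :* t :+ r :* con 0ℤ := M :* t) refl M t r
  stays-within (+ suc n) t lo hi r lo≤t t≤hi 0≤r step =
    ℤP.≤-trans (ℤP.*-monoˡ-≤-nonNeg M lo≤t)
      (subst (_≤ M * t + r * + suc n) (ℤP.+-identityʳ (M * t))
        (ℤP.+-monoʳ-≤ (M * t) (nonneg-* r (+ suc n) 0≤r (+≤+ ℕ.z≤n)))) ,
    subst (M * t + r * + suc n ≤_) to-top (ℤP.+-monoʳ-≤ (M * t) (step (λ ())))
    where
    to-top : M * t + (hi - t) * M ≡ M * hi
    to-top = solve 3 (λ M t hi → M :* t :+ (hi :- t) :* M := M :* hi) refl M t hi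
  stays-within -[1+ n ] t lo hi r lo≤t t≤hi 0≤r step =
    subst (_≤ M * t + r * -[1+ n ]) to-bottom
      (subst (M * t - (t - lo) * M ≤_) as-sum (ℤP.+-monoʳ-≤ (M * t) (ℤP.neg-mono-≤ (step (λ ()))))) ,
    ℤP.≤-trans
      (subst (M * t + r * -[1+ n ] ≤_) (ℤP.+-identityʳ (M * t))
        (subst (_≤ M * t + 0ℤ) as-sum
          (ℤP.+-monoʳ-≤ (M * t) (ℤP.neg-mono-≤ (nonneg-* r (+ suc n) 0≤r (+≤+ ℕ.z≤n))))))
      (ℤP.*-monoˡ-≤-nonNeg M t≤hi)
    where
    to-bottom : M * t - (t - lo) * M ≡ M * lo
    to-bottom = solve 3 (λ M t lo → M :* t :- (t :- lo) :* M := M :* lo) refl M t lo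
    as-sum : M * t - r * + suc n ≡ M * t + r * -[1+ n ]
    as-sum = solve 4 (λ M t r w → M :* t :- r :* w := M :* t :+ r :* (:- w)) refl M t r (+ suc n)

  becomes-tight : ∀ g t lo hi → (g ≡ + suc M′ ⊎ g ≡ -[1+ M′ ]) →
    ¬ ((M * lo < M * t + room g lo hi t * g) × (M * t + room g lo hi t * g < M * hi))
  becomes-tight .(+ suc M′) t lo hi (inj₁ refl) (_ , below-top) = ℤP.<-irrefl at-top below-top
    where
    at-top : M * t + (hi - t) * M ≡ M * hi
    at-top = solve 3 (λ M t hi → M :* t :+ (hi :- t) :* M := M :* hi) refl M t hi
  becomes-tight .(-[1+ M′ ]) t lo hi (inj₂ refl) (above-bottom , _) = ℤP.<-irrefl (sym at-bottom) above-bottom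
    where
    at-bottom : M * t + (t - lo) * -[1+ M′ ] ≡ M * lo
    at-bottom = solve 3 (λ M t lo → M :* t :+ (t :- lo) :* (:- M) := M :* lo) refl M t lo

argmin : ∀ {m} (key : Fin m → ℚᵘ) (P : Fin m → Bool) (e : Fin m) → P e ≡ true →
  Σ (Fin m) λ k → P k ≡ true × (∀ j → P j ≡ true → key k ℚᵘ.≤ key j)
argmin {suc m} key P e Pe with any? (λ k → P (suc k) BoolP.≟ true)
argmin {suc m} key P zero    Pe | no none = zero , Pe , λ { zero _ → ℚᵘP.≤-refl ; (suc j) Pj → ⊥-elim (none (j , Pj)) }
argmin {suc m} key P (suc e) Pe | no none = ⊥-elim (none (e , Pe))
argmin {suc m} key P e Pe | yes (e′ , Pe′) with argmin (λ k → key (suc k)) (λ k → P (suc k)) e′ Pe′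
... | k , Pk , min-k with P zero in P0
...   | false = suc k , Pk , λ { zero P0′ → ⊥-elim (BoolP.not-¬ P0 P0′) ; (suc j) Pj → min-k j Pj }
...   | true with ℚᵘP.≤-total (key zero) (key (suc k))
...     | inj₁ ≤k = zero , P0 , λ { zero _ → ℚᵘP.≤-refl ; (suc j) Pj → ℚᵘP.≤-trans ≤k (min-k j Pj) }
...     | inj₂ k≤ = suc k , Pk , λ { zero _ → k≤ ; (suc j) Pj → min-k j Pj }

-- The proof
-- is an algorithm on scaled circulations: while some edge strictly inside its bounds
-- carries a value not divisible by the denominator, the cycle lemma provides a
-- circulation through it inside the free edges, and a push along it makes one more
-- edge tight.  When it stops, every value is divisible and the denominator cancels.
module Integrality {n m : ℕ} (src tgt : Fin m → Fin n) (α β : Fin m → ℤ) where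

  open Flows src tgt

  -- a circulation between the bounds, with values scaled by the denominator d + 1
  record Scaled : Set where
    constructor scaled
    field
      d           : ℕ
      T           : Fin m → ℤ
      bounded     : ∀ k → (+ suc d * α k ≤ T k) × (T k ≤ + suc d * β k)
      circulation : Circulation T

    D : ℤ
    D = + suc d

    Free : Fin m → Set
    Free k = (D * α k < T k) × (T k < D * β k)

    free : Fin m → Bool
    free k = does ((D * α k ℤP.<? T k) ×-dec (T k ℤP.<? D * β k))

    tight-divisible : ∀ k → free k ≡ false → D ∣ T k
    tight-divisible k not-free with D * α k ℤP.≟ T k
    ... | yes at-α = divides (α k) (trans (sym at-α) (ℤP.*-comm D (α k)))
    ... | no  ≢α with T k ℤP.≟ D * β k
    ...   | yes at-β = divides (β k) (trans at-β (ℤP.*-comm D (β k)))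
    ...   | no  ≢β = ⊥-elim (does-false ((D * α k ℤP.<? T k) ×-dec (T k ℤP.<? D * β k)) not-free
                       (ℤP.≤∧≢⇒< (proj₁ (bounded k)) ≢α , ℤP.≤∧≢⇒< (proj₂ (bounded k)) ≢β))

  open Scaled

  Solution : Set
  Solution = Σ (Fin m → ℤ) λ τ → (∀ k → (α k ≤ τ k) × (τ k ≤ β k)) × Circulation τ

  divide-out : (S : Scaled) → (∀ k → D S ∣ T S k) → Solution
  divide-out S D∣T = τ , τ-bounded , τ-circulation
    where
    τ : Fin m → ℤ
    τ k = ℤ∣.quotient (D∣T k)
    T≡τD : ∀ k → T S k ≡ τ k * D S
    T≡τD k = _∣_.equality (D∣T k)
    τ-bounded : ∀ k → (α k ≤ τ k) × (τ k ≤ β k)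
    τ-bounded k =
      ℤP.*-cancelʳ-≤-pos (α k) (τ k) (D S) (subst₂ _≤_ (ℤP.*-comm (D S) (α k)) (T≡τD k) (proj₁ (bounded S k))) ,
      ℤP.*-cancelʳ-≤-pos (τ k) (β k) (D S) (subst₂ _≤_ (T≡τD k) (ℤP.*-comm (D S) (β k)) (proj₂ (bounded S k)))
    τ-circulation : Circulation τ
    τ-circulation s = ℤP.*-cancelˡ-≡ (D S) (div τ s) 0ℤ (begin
      D S * div τ s            ≡⟨ sym (ℤP.+-identityʳ _) ⟩
      D S * div τ s + 0ℤ * div τ s ≡⟨ sym (div-lin (D S) 0ℤ τ τ s) ⟩
      div (λ k → D S * τ k + 0ℤ * τ k) s
        ≡⟨ sum-cong (λ k → cong (_* inc k s) (trans (ℤP.+-identityʳ _) (trans (ℤP.*-comm (D S) (τ k)) (sym (T≡τD k))))) ⟩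
      div (T S) s             ≡⟨ circulation S s ⟩
      0ℤ                      ≡⟨ sym (ℤP.*-zeroʳ (D S)) ⟩
      D S * 0ℤ ∎)
      where open ≡-Reasoning

  -- Given a circulation g that vanishes on the non-free edges
  -- and is nonzero at e, push along g until the first edge reaches a bound:
  -- among the edges with g k ≠ 0 choose k* minimising room / ∣ g ∣, and take
  -- T′ = M T + r g with M = ∣ g k* ∣ and r the room of k*.  Non-free edges stay
  -- non-free and k* becomes non-free, so the number of free edges drops.
  push : (S : Scaled) (g : Fin m → ℤ) (e : Fin m) → Circulation g → g e ≡ 1ℤ →
    (∀ k → free S k ≡ false → g k ≡ 0ℤ) →
    Σ Scaled λ S′ → count (free S′) ℕ.< count (free S)
  push S g e circ-g g-e supp = S′ , fewer-free
    where
    lo hi : Fin m → ℤ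
    lo k = D S * α k
    hi k = D S * β k

    key : Fin m → ℚᵘ
    key k = mkℚᵘ (room (g k) (lo k) (hi k) (T S k)) pred∣ g k ∣

    moving : Fin m → Bool
    moving k = not (does (g k ℤP.≟ 0ℤ))

    moving-≢0 : ∀ k → g k ≢ 0ℤ → moving k ≡ true
    moving-≢0 k g≢0 = cong not (dec-false (g k ℤP.≟ 0ℤ) g≢0)

    chosen = argmin key moving e (moving-≢0 e (λ g≡0 → 1≢0 (trans (sym g-e) g≡0)))
      where
      1≢0 : 1ℤ ≢ 0ℤ
      1≢0 ()
    k* : Fin m
    k* = proj₁ chosen

    open PushArithmetic pred∣ g k* ∣

    r : ℤ
    r = room (g k*) (lo k*) (hi k*) (T S k*)

    d′ : ℕ
    d′ = d S ℕ.+ pred∣ g k* ∣ ℕ.* suc (d S)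

    T′ : Fin m → ℤ
    T′ k = M * T S k + r * g k

    rescale : ∀ x → + suc d′ * x ≡ M * (D S * x)
    rescale x = trans (cong (_* x) (ℤP.pos-* (suc pred∣ g k* ∣) (suc (d S)))) (ℤP.*-assoc M (D S) x)

    bounded′ : ∀ k → (+ suc d′ * α k ≤ T′ k) × (T′ k ≤ + suc d′ * β k)
    bounded′ k with stays-within (g k) (T S k) (lo k) (hi k) r (proj₁ (bounded S k)) (proj₂ (bounded S k))
                      (room-nonneg (g k*) (lo k*) (hi k*) (T S k*) (proj₁ (bounded S k*)) (proj₂ (bounded S k*)))
                      (λ g≢0 → ℚᵘP.drop-*≤* (proj₂ (proj₂ chosen) k (moving-≢0 k g≢0)))
    ... | above , below = subst (_≤ T′ k) (sym (rescale (α k))) above , subst (T′ k ≤_) (sym (rescale (β k))) below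

    S′ : Scaled
    S′ = scaled d′ T′ bounded′ (circulation-lin M r {T S} {g} (circulation S) circ-g)

    -- an edge not moved by g keeps its (non-)freeness
    free-stays : Implies (free S′) (free S)
    free-stays k free′ with free S k in not-free
    ... | true  = refl
    ... | false = ⊥-elim (does-false ((D S * α k ℤP.<? T S k) ×-dec (T S k ℤP.<? D S * β k)) not-free
                    (ℤP.*-cancelˡ-<-nonNeg M (subst (λ u → M * lo k < u) unmoved (subst (_< T′ k) (rescale (α k)) (proj₁ F′))) ,
                     ℤP.*-cancelˡ-<-nonNeg M (subst (λ u → u < M * hi k) unmoved (subst (T′ k <_) (rescale (β k)) (proj₂ F′)))))
      where
      F′ : Free S′ k
      F′ = does-true ((D S′ * α k ℤP.<? T′ k) ×-dec (T′ k ℤP.<? D S′ * β k)) free′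
      unmoved : T′ k ≡ M * T S k
      unmoved rewrite supp k not-free = trans (cong (_+_ (M * T S k)) (ℤP.*-zeroʳ r)) (ℤP.+-identityʳ _)

    sign-k* : g k* ≡ + suc pred∣ g k* ∣ ⊎ g k* ≡ -[1+ pred∣ g k* ∣ ]
    sign-k* with g k* | proj₁ (proj₂ chosen)
    ... | + suc _  | _ = inj₁ refl
    ... | -[1+ _ ] | _ = inj₂ refl

    k*-tight : free S′ k* ≡ false
    k*-tight = dec-false ((D S′ * α k* ℤP.<? T′ k*) ×-dec (T′ k* ℤP.<? D S′ * β k*)) λ F′ →
      becomes-tight (g k*) (T S k*) (lo k*) (hi k*) sign-k*
        (subst (_< T′ k*) (rescale (α k*)) (proj₁ F′) , subst (T′ k* <_) (rescale (β k*)) (proj₂ F′))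

    k*-was-free : free S k* ≡ true
    k*-was-free with free S k* in fk
    ... | true  = refl
    ... | false = ⊥-elim (BoolP.not-¬ (cong (λ u → not (does (u ℤP.≟ 0ℤ))) (supp k* fk)) (proj₁ (proj₂ chosen)))

    fewer-free : count (free S′) ℕ.< count (free S)
    fewer-free = count-strict (free S′) (free S) free-stays k* k*-tight k*-was-free

  integralise : (fuel : ℕ) (S : Scaled) → count (free S) ℕ.≤ fuel → Solution
  integralise fuel S bound with any? (λ k → (free S k BoolP.≟ true) ×-dec ¬? (D S ∣? T S k))
  ... | no none = divide-out S D∣T
    where
    D∣T : ∀ k → D S ∣ T S k
    D∣T k with free S k in fk | D S ∣? T S k
    ... | _     | yes D∣Tk = D∣Tk
    ... | true  | no  D∤Tk = ⊥-elim (none (k , fk , D∤Tk))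
    ... | false | no  _    = tight-divisible S k fk
  integralise zero S bound | yes (e , free-e , _) = ⊥-elim (ℕP.<⇒≱ (count-pos (free S) e free-e) bound)
  integralise (suc fuel) S bound | yes (e , free-e , D∤Te) =
    integralise fuel (proj₁ next) (ℕP.≤-pred (ℕP.<-≤-trans (proj₂ next) bound))
    where
    cycle : Σ (Fin m → ℤ) λ g → Circulation g × g e ≡ 1ℤ × (∀ k → free S k ≡ false → g k ≡ 0ℤ)
    cycle = cycle-through (D S) (T S) (free S) e (circulation S) (tight-divisible S) free-e D∤Te
    next : Σ Scaled λ S′ → count (free S′) ℕ.< count (free S)
    next = push S (proj₁ cycle) e (proj₁ (proj₂ cycle)) (proj₁ (proj₂ (proj₂ cycle))) (proj₂ (proj₂ (proj₂ cycle)))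

  integral-circulation : (d : ℕ) (T : Fin m → ℤ) →
    (∀ k → (+ suc d * α k ≤ T k) × (T k ≤ + suc d * β k)) → Circulation T → Solution
  integral-circulation d T bounded circ =
    integralise m (scaled d T bounded circ) (count≤ _)

toℚᵘ-toℚ : ∀ z → ℚ.toℚᵘ (toℚ z) ℚᵘ.≃ mkℚᵘ z 0
toℚᵘ-toℚ z = ℚP.toℚᵘ-fromℚᵘ (mkℚᵘ z 0)

toℚ-+ : ∀ a b → toℚ (a + b) ≡ toℚ a ℚ.+ toℚ b
toℚ-+ a b = ℚP.toℚᵘ-injective (ℚᵘP.≃-trans (toℚᵘ-toℚ (a + b)) (ℚᵘP.≃-sym (ℚᵘP.≃-trans
  (ℚP.toℚᵘ-homo-+ (toℚ a) (toℚ b))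
  (ℚᵘP.≃-trans (ℚᵘP.+-cong (toℚᵘ-toℚ a) (toℚᵘ-toℚ b))
    (*≡* (cong (_* 1ℤ) (cong₂ _+_ (ℤP.*-identityʳ a) (ℤP.*-identityʳ b))))))))

toℚ-* : ∀ a b → toℚ (a * b) ≡ toℚ a ℚ.* toℚ b
toℚ-* a b = ℚP.toℚᵘ-injective (ℚᵘP.≃-trans (toℚᵘ-toℚ (a * b)) (ℚᵘP.≃-sym (ℚᵘP.≃-trans
  (ℚP.toℚᵘ-homo-* (toℚ a) (toℚ b))
  (ℚᵘP.≃-trans (ℚᵘP.*-cong (toℚᵘ-toℚ a) (toℚᵘ-toℚ b)) (*≡* refl)))))

toℚ-injective : ∀ a b → toℚ a ≡ toℚ b → a ≡ b
toℚ-injective a b eq with ℚᵘP.≃-trans (ℚᵘP.≃-sym (toℚᵘ-toℚ a)) (ℚᵘP.≃-trans (ℚᵘP.≃-reflexive (cong ℚ.toℚᵘ eq)) (toℚᵘ-toℚ b))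
... | *≡* a1≡b1 = trans (sym (ℤP.*-identityʳ a)) (trans a1≡b1 (ℤP.*-identityʳ b))

toℚ-sum : ∀ {p} (f : Fin p → ℤ) → toℚ (sumℤ f) ≡ sumℚ (λ i → toℚ (f i))
toℚ-sum {zero}  f = refl
toℚ-sum {suc p} f = trans (toℚ-+ (f zero) _) (cong (toℚ (f zero) ℚ.+_) (toℚ-sum (λ i → f (suc i))))

sumℚ-cong : ∀ {p} {f g : Fin p → ℚ} → (∀ i → f i ≡ g i) → sumℚ f ≡ sumℚ g
sumℚ-cong {zero}  eq = refl
sumℚ-cong {suc p} eq = cong₂ ℚ._+_ (eq zero) (sumℚ-cong (λ i → eq (suc i)))

sumℚ-scale : ∀ {p} c (f : Fin p → ℚ) → sumℚ (λ i → c ℚ.* f i) ≡ c ℚ.* sumℚ f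
sumℚ-scale {zero}  c f = sym (ℚP.*-zeroʳ c)
sumℚ-scale {suc p} c f = trans (cong (c ℚ.* f zero ℚ.+_) (sumℚ-scale c (λ i → f (suc i))))
                               (sym (ℚP.*-distribˡ-+ c (f zero) _))

numerator-denominator : ∀ q → toℚ (↥ q) ≡ toℚ (↧ q) ℚ.* q
numerator-denominator q@(ℚ.mkℚ n d-1 _) = ℚP.toℚᵘ-injective (ℚᵘP.≃-trans (toℚᵘ-toℚ n) (ℚᵘP.≃-sym (ℚᵘP.≃-trans
  (ℚP.toℚᵘ-homo-* (toℚ (+ suc d-1)) q)
  (ℚᵘP.≃-trans (ℚᵘP.*-cong (toℚᵘ-toℚ (+ suc d-1)) (ℚᵘP.≃-refl {ℚ.toℚᵘ q}))
    (*≡* (trans (trans (ℤP.*-identityʳ _) (ℤP.*-comm (+ suc d-1) n))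
                (cong (λ u → n * + suc u) (sym (ℕP.+-identityʳ d-1)))))))))

lower-bound : ∀ a q → toℚ a ℚ.≤ q → a * ↧ q ≤ ↥ q
lower-bound a q@(ℚ.mkℚ n _ _) a≤q with ℚᵘP.≤-respˡ-≃ (toℚᵘ-toℚ a) (ℚP.toℚᵘ-mono-≤ a≤q)
... | *≤* h = subst (a * ↧ q ≤_) (ℤP.*-identityʳ n) h

upper-bound : ∀ b q → q ℚ.≤ toℚ b → ↥ q ≤ b * ↧ q
upper-bound b q@(ℚ.mkℚ n _ _) q≤b with ℚᵘP.≤-respʳ-≃ (toℚᵘ-toℚ b) (ℚP.toℚᵘ-mono-≤ q≤b)
... | *≤* h = subst (_≤ b * ↧ q) (ℤP.*-identityʳ n) h

record CommonDenominator {p} (x : Fin p → ℚ) : Set where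
  field
    d        : ℕ
    cofactor : Fin p → ℕ
    factors  : ∀ r → + suc d ≡ ↧ (x r) * + suc (cofactor r)

commonDenominator : ∀ {p} (x : Fin p → ℚ) → CommonDenominator x
commonDenominator {zero}  x = record { d = 0 ; cofactor = λ () ; factors = λ () }
commonDenominator {suc p} x = record { d = d′ ; cofactor = cofactor′ ; factors = factors′ }
  where
  open CommonDenominator (commonDenominator (λ i → x (suc i)))
  k : ℕ
  k = ℚ.denominator-1 (x zero)
  d′ : ℕ
  d′ = d ℕ.+ k ℕ.* suc d
  cofactor′ : Fin (suc p) → ℕ
  cofactor′ zero    = d
  cofactor′ (suc i) = k ℕ.+ cofactor i ℕ.* suc k
  factors′ : ∀ r → + suc d′ ≡ ↧ (x r) * + suc (cofactor′ r)
  factors′ zero    = ℤP.pos-* (suc k) (suc d)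
  factors′ (suc i) = begin
    + suc d′                                          ≡⟨ ℤP.pos-* (suc k) (suc d) ⟩
    + suc k * + suc d                                 ≡⟨ cong (+ suc k *_) (factors i) ⟩
    + suc k * (↧ (x (suc i)) * + suc (cofactor i))    ≡⟨ rotate (+ suc k) (↧ (x (suc i))) (+ suc (cofactor i)) ⟩
    ↧ (x (suc i)) * (+ suc (cofactor i) * + suc k)    ≡⟨ cong (↧ (x (suc i)) *_) (sym (ℤP.pos-* (suc (cofactor i)) (suc k))) ⟩
    ↧ (x (suc i)) * + suc (cofactor′ (suc i)) ∎
    where
    open ≡-Reasoning
    rotate : ∀ a b c → a * (b * c) ≡ b * (c * a)
    rotate a b c = trans (ℤP.*-comm a (b * c)) (ℤP.*-assoc b c a)

record Cleared {p} (x : Fin p → ℚ) : Set where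
  field
    d      : ℕ
    X      : Fin p → ℤ
    scaled : ∀ r → toℚ (X r) ≡ toℚ (+ suc d) ℚ.* x r
    lower  : ∀ r a → toℚ a ℚ.≤ x r → + suc d * a ≤ X r
    upper  : ∀ r b → x r ℚ.≤ toℚ b → X r ≤ + suc d * b

clear : ∀ {p} (x : Fin p → ℚ) → Cleared x
clear {p} x = record { d = d ; X = X ; scaled = scaled ; lower = lower ; upper = upper }
  where
  open CommonDenominator (commonDenominator x)
  D : ℤ
  D = + suc d
  X : Fin p → ℤ
  X r = ↥ (x r) * + suc (cofactor r)
  scaled : ∀ r → toℚ (X r) ≡ toℚ D ℚ.* x r
  scaled r = begin
    toℚ (↥ (x r) * C)                     ≡⟨ toℚ-* (↥ (x r)) C ⟩
    toℚ (↥ (x r)) ℚ.* toℚ C               ≡⟨ cong (ℚ._* toℚ C) (numerator-denominator (x r)) ⟩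
    (toℚ (↧ (x r)) ℚ.* x r) ℚ.* toℚ C     ≡⟨ ℚP.*-assoc (toℚ (↧ (x r))) (x r) (toℚ C) ⟩
    toℚ (↧ (x r)) ℚ.* (x r ℚ.* toℚ C)     ≡⟨ cong (toℚ (↧ (x r)) ℚ.*_) (ℚP.*-comm (x r) (toℚ C)) ⟩
    toℚ (↧ (x r)) ℚ.* (toℚ C ℚ.* x r)     ≡⟨ ℚP.*-assoc (toℚ (↧ (x r))) (toℚ C) (x r) ⟨
    (toℚ (↧ (x r)) ℚ.* toℚ C) ℚ.* x r     ≡⟨ cong (ℚ._* x r) (toℚ-* (↧ (x r)) C) ⟨
    toℚ (↧ (x r) * C) ℚ.* x r             ≡⟨ cong (λ u → toℚ u ℚ.* x r) (factors r) ⟨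
    toℚ D ℚ.* x r ∎
    where
    open ≡-Reasoning
    C : ℤ
    C = + suc (cofactor r)
  rescaled : ∀ r z → (z * ↧ (x r)) * + suc (cofactor r) ≡ D * z
  rescaled r z = trans (ℤP.*-assoc z (↧ (x r)) (+ suc (cofactor r)))
                       (trans (cong (z *_) (sym (factors r))) (ℤP.*-comm z D))
  lower : ∀ r a → toℚ a ℚ.≤ x r → D * a ≤ X r
  lower r a a≤x = subst (_≤ X r) (rescaled r a)
    (ℤP.*-monoʳ-≤-nonNeg (+ suc (cofactor r)) (lower-bound a (x r) a≤x))
  upper : ∀ r b → x r ℚ.≤ toℚ b → X r ≤ D * b
  upper r b x≤b = subst (X r ≤_) (rescaled r b)
    (ℤP.*-monoʳ-≤-nonNeg (+ suc (cofactor r)) (upper-bound b (x r) x≤b))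

clear-combination : ∀ {p N} (v : Fin p → Fin N → ℤ) (x : Fin p → ℚ) (w : Fin N → ℤ) →
  (∀ t → combℚ v x t ≡ toℚ (w t)) → let open Cleared (clear x) in
  ∀ t → combℤ v X t ≡ + suc d * w t
clear-combination v x w hx t = toℚ-injective _ _ (begin
  toℚ (sumℤ (λ r → X r * v r t))             ≡⟨ toℚ-sum (λ r → X r * v r t) ⟩
  sumℚ (λ r → toℚ (X r * v r t))             ≡⟨ sumℚ-cong (λ r → trans (toℚ-* (X r) (v r t))
                                                  (trans (cong (ℚ._* toℚ (v r t)) (scaled r)) (ℚP.*-assoc (toℚ D) (x r) (toℚ (v r t))))) ⟩
  sumℚ (λ r → toℚ D ℚ.* (x r ℚ.* toℚ (v r t))) ≡⟨ sumℚ-scale (toℚ D) (λ r → x r ℚ.* toℚ (v r t)) ⟩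
  toℚ D ℚ.* combℚ v x t                      ≡⟨ cong (toℚ D ℚ.*_) (hx t) ⟩
  toℚ D ℚ.* toℚ (w t)                        ≡⟨ toℚ-* D (w t) ⟨
  toℚ (D * w t) ∎)
  where
  open Cleared (clear x)
  open ≡-Reasoning
  D : ℤ
  D = + suc d

split-cases : ∀ {p q} (P : Fin (p ℕ.+ q) → Set) → (∀ k → P (k ↑ˡ q)) → (∀ l → P (p ↑ʳ l)) → ∀ r → P r
split-cases {p} P left right r with splitAt p r in eq
... | inj₁ k = subst P (splitAt⁻¹-↑ˡ eq) (left k)
... | inj₂ l = subst P (splitAt⁻¹-↑ʳ eq) (right l)

comb-+ : ∀ {p N} (v : Fin p → Fin N → ℤ) f g t →
  combℤ v (λ r → f r + g r) t ≡ combℤ v f t + combℤ v g t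
comb-+ v f g t = trans (sum-cong (λ r → ℤP.*-distribʳ-+ (v r t) (f r) (g r)))
                       (sum-+ (λ r → f r * v r t) (λ r → g r * v r t))

shift-lower : ∀ {a c t} → a - c ≤ t → a ≤ c + t
shift-lower {a} {c} {t} h = subst (_≤ c + t) (solve 2 (λ a c → c :+ (a :- c) := a) refl a c) (ℤP.+-monoʳ-≤ c h)

shift-upper : ∀ {b c t} → t ≤ b - c → c + t ≤ b
shift-upper {b} {c} {t} h = subst (c + t ≤_) (solve 2 (λ b c → c :+ (b :- c) := b) refl b c) (ℤP.+-monoʳ-≤ c h)

reflect-lower : ∀ {a c t} → t ≤ c - a → a ≤ c - t
reflect-lower {a} {c} {t} h = subst (_≤ c - t) (solve 2 (λ a c → c :- (c :- a) := a) refl a c)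
                                (ℤP.+-monoʳ-≤ c (ℤP.neg-mono-≤ h))

reflect-upper : ∀ {b c t} → c - b ≤ t → c - t ≤ b
reflect-upper {b} {c} {t} h = subst (c - t ≤_) (solve 2 (λ b c → c :- (c :- b) := b) refl b c)
                                (ℤP.+-monoʳ-≤ c (ℤP.neg-mono-≤ h))

module ZFamily {n m : ℕ} (G : SimpleGraph n m) where

  src tgt : Fin m → Fin n
  src k = proj₁ (edge G k)
  tgt k = proj₂ (edge G k)

  open Flows src tgt

  onZ onZ′ : (Fin (m ℕ.+ m) → ℤ) → Fin m → ℤ
  onZ  u k = u (k ↑ˡ m)
  onZ′ u k = u (m ↑ʳ k)

  z-vertex : ∀ k s → zFamily G (k ↑ˡ m) (s ↑ˡ m) ≡ inc k s
  z-vertex k s rewrite splitAt-↑ˡ m k m | splitAt-↑ˡ n s m = refl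

  z′-vertex : ∀ k s → zFamily G (m ↑ʳ k) (s ↑ˡ m) ≡ - inc k s
  z′-vertex k s rewrite splitAt-↑ʳ m m k | splitAt-↑ˡ n s m =
    solve 2 (λ u v → v :- u := :- (u :- v)) refl (δ (src k) s) (δ (tgt k) s)

  z-edge : ∀ k l → zFamily G (k ↑ˡ m) (n ↑ʳ l) ≡ δ k l
  z-edge k l rewrite splitAt-↑ˡ m k m | splitAt-↑ʳ n m l = refl

  z′-edge : ∀ k l → zFamily G (m ↑ʳ k) (n ↑ʳ l) ≡ δ k l
  z′-edge k l rewrite splitAt-↑ʳ m m k | splitAt-↑ʳ n m l = refl

  comb-vertex : ∀ u s → combℤ (zFamily G) u (s ↑ˡ m) ≡ div (onZ u) s - div (onZ′ u) s
  comb-vertex u s = trans (sum-split {m} {m} (λ r → u r * zFamily G r (s ↑ˡ m)))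
    (cong₂ _+_ (sum-cong (λ k → cong (onZ u k *_) (z-vertex k s)))
               (trans (sum-cong (λ k → trans (cong (onZ′ u k *_) (z′-vertex k s)) (sym (ℤP.neg-distribʳ-* (onZ′ u k) (inc k s)))))
                      (sum-neg (λ k → onZ′ u k * inc k s))))

  comb-edge : ∀ u l → combℤ (zFamily G) u (n ↑ʳ l) ≡ onZ u l + onZ′ u l
  comb-edge u l = trans (sum-split {m} {m} (λ r → u r * zFamily G r (n ↑ʳ l)))
    (cong₂ _+_ (trans (sum-cong (λ k → cong (onZ u k *_) (z-edge k l))) (sum-δʳ (onZ u) l))
               (trans (sum-cong (λ k → cong (onZ′ u k *_) (z′-edge k l))) (sum-δʳ (onZ′ u) l)))

  kernel⇒circulation : ∀ u → (∀ t → combℤ (zFamily G) u t ≡ 0ℤ) →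
    (∀ k → onZ′ u k ≡ - onZ u k) × Circulation (onZ u)
  kernel⇒circulation u comb≡0 = opposite , circulation
    where
    opposite : ∀ k → onZ′ u k ≡ - onZ u k
    opposite k = inverseʳ-unique (onZ u k) (onZ′ u k) (trans (sym (comb-edge u k)) (comb≡0 (n ↑ʳ k)))
    circulation : Circulation (onZ u)
    circulation s = ℤP.*-cancelˡ-≡ (+ 2) (div (onZ u) s) 0ℤ (begin
      + 2 * div (onZ u) s                    ≡⟨ solve 1 (λ x → con (+ 2) :* x := x :- (:- x)) refl (div (onZ u) s) ⟩
      div (onZ u) s - - div (onZ u) s         ≡⟨ cong (_-_ (div (onZ u) s)) (div-neg (onZ u) s) ⟨
      div (onZ u) s - div (λ k → - onZ u k) s ≡⟨ cong (_-_ (div (onZ u) s)) (div-cong opposite s) ⟨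
      div (onZ u) s - div (onZ′ u) s          ≡⟨ comb-vertex u s ⟨
      combℤ (zFamily G) u (s ↑ˡ m)            ≡⟨ comb≡0 (s ↑ˡ m) ⟩
      0ℤ                                      ≡⟨ ℤP.*-zeroʳ (+ 2) ⟨
      + 2 * 0ℤ ∎)
      where open ≡-Reasoning

  lift : (Fin m → ℤ) → Fin (m ℕ.+ m) → ℤ
  lift τ r = [ τ , (λ k → - τ k) ]′ (splitAt m r)

  lift-onZ : ∀ τ k → onZ (lift τ) k ≡ τ k
  lift-onZ τ k rewrite splitAt-↑ˡ m k m = refl

  lift-onZ′ : ∀ τ k → onZ′ (lift τ) k ≡ - τ k
  lift-onZ′ τ k rewrite splitAt-↑ʳ m m k = refl

  circulation⇒kernel : ∀ τ → Circulation τ → ∀ t → combℤ (zFamily G) (lift τ) t ≡ 0ℤ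
  circulation⇒kernel τ circ = split-cases (λ t → combℤ (zFamily G) (lift τ) t ≡ 0ℤ) at-vertex at-edge
    where
    at-vertex : ∀ s → combℤ (zFamily G) (lift τ) (s ↑ˡ m) ≡ 0ℤ
    at-vertex s = begin
      combℤ (zFamily G) (lift τ) (s ↑ˡ m)         ≡⟨ comb-vertex (lift τ) s ⟩
      div (onZ (lift τ)) s - div (onZ′ (lift τ)) s ≡⟨ cong₂ _-_ (div-cong (lift-onZ τ) s) (div-cong (lift-onZ′ τ) s) ⟩
      div τ s - div (λ k → - τ k) s               ≡⟨ cong (_-_ (div τ s)) (div-neg τ s) ⟩
      div τ s - - div τ s                         ≡⟨ cong₂ (λ x y → x - - y) (circ s) (circ s) ⟩
      0ℤ ∎
      where open ≡-Reasoning
    at-edge : ∀ l → combℤ (zFamily G) (lift τ) (n ↑ʳ l) ≡ 0ℤ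
    at-edge l = trans (comb-edge (lift τ) l)
      (trans (cong₂ _+_ (lift-onZ τ l) (lift-onZ′ τ l)) (ℤP.+-inverseʳ (τ l)))

module Rounding {n m : ℕ} (G : SimpleGraph n m) (a b : Fin (m ℕ.+ m) → ℤ) (w : Fin (n ℕ.+ m) → ℤ)
  (c : Fin (m ℕ.+ m) → ℤ) (c-represents : ∀ t → combℤ (zFamily G) c t ≡ w t)
  (x : Fin (m ℕ.+ m) → ℚ) (x-bounded : ∀ r → (toℚ (a r) ℚ.≤ x r) × (x r ℚ.≤ toℚ (b r)))
  (x-represents : ∀ t → combℚ (zFamily G) x t ≡ toℚ (w t)) where

  open ZFamily G
  open Flows src tgt
  open Cleared (clear x)

  D : ℤ
  D = + suc d

  U : Fin (m ℕ.+ m) → ℤ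
  U r = X r - D * c r

  U-kernel : ∀ t → combℤ (zFamily G) U t ≡ 0ℤ
  U-kernel t = begin
    sumℤ (λ r → (X r - D * c r) * zFamily G r t)
      ≡⟨ sum-cong (λ r → expand (X r) D (c r) (zFamily G r t)) ⟩
    sumℤ (λ r → X r * zFamily G r t + - D * (c r * zFamily G r t))
      ≡⟨ sum-+ (λ r → X r * zFamily G r t) (λ r → - D * (c r * zFamily G r t)) ⟩
    combℤ (zFamily G) X t + sumℤ (λ r → - D * (c r * zFamily G r t))
      ≡⟨ cong₂ _+_ (clear-combination (zFamily G) x w x-represents t)
                   (trans (sum-scale (- D) (λ r → c r * zFamily G r t)) (cong (- D *_) (c-represents t))) ⟩
    D * w t + - D * w t
      ≡⟨ solve 2 (λ D w → D :* w :+ (:- D) :* w := con 0ℤ) refl D (w t) ⟩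
    0ℤ ∎
    where
    open ≡-Reasoning
    expand : ∀ X D c v → (X - D * c) * v ≡ X * v + - D * (c * v)
    expand = solve 4 (λ X D c v → (X :- D :* c) :* v := X :* v :+ (:- D) :* (c :* v)) refl

  U-bounded : ∀ r → (D * (a r - c r) ≤ U r) × (U r ≤ D * (b r - c r))
  U-bounded r = subst (_≤ U r) (distrib (a r)) (ℤP.+-monoˡ-≤ (- (D * c r)) (lower r (a r) (proj₁ (x-bounded r)))) ,
                subst (U r ≤_) (distrib (b r)) (ℤP.+-monoˡ-≤ (- (D * c r)) (upper r (b r) (proj₂ (x-bounded r))))
    where
    distrib : ∀ z → D * z - D * c r ≡ D * (z - c r)
    distrib z = solve 3 (λ D z c → D :* z :- D :* c := D :* (z :- c)) refl D z (c r)

  T : Fin m → ℤ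
  T = onZ U

  T-circulation : Circulation T
  T-circulation = proj₂ (kernel⇒circulation U U-kernel)

  -- the two halves of the box both constrain T: α ≤ T / D ≤ β
  α β : Fin m → ℤ
  α k = (onZ a k - onZ c k) ⊔ (onZ′ c k - onZ′ b k)
  β k = (onZ b k - onZ c k) ⊓ (onZ′ c k - onZ′ a k)

  T-bounded : ∀ k → (D * α k ≤ T k) × (T k ≤ D * β k)
  T-bounded k =
    subst (_≤ T k) (sym (ℤP.*-distribˡ-⊔-nonNeg D _ _)) (ℤP.⊔-lub (proj₁ (U-bounded (k ↑ˡ m))) from-z′-lower) ,
    subst (T k ≤_) (sym (ℤP.*-distribˡ-⊓-nonNeg D _ _)) (ℤP.⊓-glb (proj₂ (U-bounded (k ↑ˡ m))) from-z′-upper)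
    where
    T≡-U′ : - onZ′ U k ≡ T k
    T≡-U′ = trans (cong -_ (proj₁ (kernel⇒circulation U U-kernel) k)) (ℤP.neg-involutive (T k))
    flip : ∀ p q → - (D * (p - q)) ≡ D * (q - p)
    flip p q = solve 3 (λ D p q → :- (D :* (p :- q)) := D :* (q :- p)) refl D p q
    from-z′-lower : D * (onZ′ c k - onZ′ b k) ≤ T k
    from-z′-lower = subst₂ _≤_ (flip (onZ′ b k) (onZ′ c k)) T≡-U′ (ℤP.neg-mono-≤ (proj₂ (U-bounded (m ↑ʳ k))))
    from-z′-upper : T k ≤ D * (onZ′ c k - onZ′ a k)
    from-z′-upper = subst₂ _≤_ T≡-U′ (flip (onZ′ a k) (onZ′ c k)) (ℤP.neg-mono-≤ (proj₁ (U-bounded (m ↑ʳ k))))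

  open Integrality src tgt α β using (Solution; integral-circulation)

  -- opaque: the solution is only used through its specification, never computed
  opaque
    τ-solution : Solution
    τ-solution = integral-circulation d T T-bounded T-circulation

  τ : Fin m → ℤ
  τ = proj₁ τ-solution

  y : Fin (m ℕ.+ m) → ℤ
  y r = c r + lift τ r

  y-represents : ∀ t → combℤ (zFamily G) y t ≡ w t
  y-represents t = begin
    combℤ (zFamily G) y t                                  ≡⟨ comb-+ (zFamily G) c (lift τ) t ⟩
    combℤ (zFamily G) c t + combℤ (zFamily G) (lift τ) t   ≡⟨ cong₂ _+_ (c-represents t) (circulation⇒kernel τ (proj₂ (proj₂ τ-solution)) t) ⟩
    w t + 0ℤ                                               ≡⟨ ℤP.+-identityʳ (w t) ⟩
    w t ∎
    where open ≡-Reasoning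

  y-bounded : ∀ r → (a r ≤ y r) × (y r ≤ b r)
  y-bounded = split-cases (λ r → (a r ≤ y r) × (y r ≤ b r)) on-z on-z′
    where
    α≤τ : ∀ k → α k ≤ τ k
    α≤τ k = proj₁ (proj₁ (proj₂ τ-solution) k)
    τ≤β : ∀ k → τ k ≤ β k
    τ≤β k = proj₂ (proj₁ (proj₂ τ-solution) k)
    on-z : ∀ k → (a (k ↑ˡ m) ≤ y (k ↑ˡ m)) × (y (k ↑ˡ m) ≤ b (k ↑ˡ m))
    on-z k rewrite lift-onZ τ k =
      shift-lower (ℤP.≤-trans (ℤP.i≤i⊔j _ _) (α≤τ k)) , shift-upper (ℤP.≤-trans (τ≤β k) (ℤP.i⊓j≤i _ _))
    on-z′ : ∀ k → (a (m ↑ʳ k) ≤ y (m ↑ʳ k)) × (y (m ↑ʳ k) ≤ b (m ↑ʳ k))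
    on-z′ k rewrite lift-onZ′ τ k =
      reflect-lower {c = c (m ↑ʳ k)} (ℤP.≤-trans (τ≤β k) (ℤP.i⊓j≤j _ _)) ,
      reflect-upper {c = c (m ↑ʳ k)} (ℤP.≤-trans (ℤP.i≤j⊔i _ _) (α≤τ k))

-- Proposition 4.10.
proposition4p10 : (n m : ℕ) (G : SimpleGraph n m) → Connected G →
    FarkasRelated (zFamily G)
proposition4p10 n m G _ a b _ w (c , c-represents) (x , x-bounded , x-represents) =
  y , y-bounded , y-represents
  where open Rounding G a b w c c-represents x x-bounded x-represents
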